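{- Let $L$ be a mathematically agreeable language, let $\mathcal L$, $D$, $G$, $F$ be as in the context, and let $W\subseteq D$ be the set of Gödel numbers of all sentences of $L$ that are true in the interpretation of $L$. Let $V$ be any subset of $W$. Then: (a) $V$ is a sound and consistent subset of $D$, i.e. $V\in\mathcal P$ and $V\subseteq G(V)$. (b) Consider all transfinite sequences $(U_\lambda)_{\lambda\in\alpha}$ of members of $\mathcal P$ (indexed by von Neumann ordinals $\alpha$) satisfying condition (C): the sequence is strictly increasing (i.e. $U_\mu\subsetneq U_\nu$ whenever $\mu\in\nu\in\alpha$), $U_0=V$, and $U_\mu=\bigcup_{\lambda\in\mu}G(U_\lambda)$ whenever $0\in\mu\in\alpha$. The last member of the union of all these sequences is the smallest consistent fixed point of $G$, i.e. the smallest $U\in\mathcal P$ (with respect to inclusion) such that $U=G(U)$.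
   Context: A language $L$ is mathematically agreeable (MA) if: it contains a countable syntax of first-order predicate logic with equality, with natural numbers among its variables' values and their names (numerals) among its terms; it is fully interpreted, i.e. each sentence of $L$ is interpreted either as true or as false (not both); classical truth tables hold for $\neg,\vee,\wedge,\rightarrow,\leftrightarrow$ and classical truth rules hold for $\forall,\exists$. Let $T$ be a monadic predicate whose domain of discourse is the set of numerals. Let $\mathcal L$ be the language whose basic sentences are the sentences of $L$, the sentences $T(\mathbf n)$ for numerals $\mathbf n$, $\forall xT(x)$ and $\exists xT(x)$, and which is closed under $\neg,\vee,\wedge,\rightarrow,\leftrightarrow$. Fix a Gödel numbering of sentences of $\mathcal L$; $\#A$ denotes the Gödel number of $A$, $\lceil A\rceil$ the numeral of $\#A$, and $D$ the set of Gödel numbers of sentences of $\mathcal L$. For $U\subseteq D$, the sets $G(U),F(U)\subseteq D$ are determined (by induction on complexity of sentences) by the rules: (r1) for a sentence $A$ of $L$, $\#A\in G(U)$ iff $A$ is true in the interpretation of $L$, and $\#A\in F(U)$ iff $A$ is false in it; (r2) for a numeral $\mathbf n$, $\#T(\mathbf n)\in G(U)$ iff $\mathbf n=\lceil A\rceil$ for a sentence $A$ of $\mathcal L$ with $\#A\in U$, and $\#T(\mathbf n)\in F(U)$ iff $\mathbf n=\lceil A\rceil$ for a sentence $A$ of $\mathcal L$ with $\#[\neg A]\in U$; (r3) $\#[\neg A]\in G(U)$ iff $\#A\in F(U)$, and $\#[\neg A]\in F(U)$ iff $\#A\in G(U)$; (r4) $\#[A\vee B]\in G(U)$ iff $\#A\in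 G(U)$ or $\#B\in G(U)$, and $\in F(U)$ iff both $\#A,\#B\in F(U)$; (r5) $\#[A\wedge B]\in G(U)$ iff both $\#A,\#B\in G(U)$, and $\in F(U)$ iff $\#A\in F(U)$ or $\#B\in F(U)$; (r6) $\#[A\rightarrow B]\in G(U)$ iff $\#A\in F(U)$ or $\#B\in G(U)$, and $\in F(U)$ iff $\#A\in G(U)$ and $\#B\in F(U)$; (r7) $\#[A\leftrightarrow B]\in G(U)$ iff $\#A,\#B$ are both in $G(U)$ or both in $F(U)$, and $\in F(U)$ iff one of $\#A,\#B$ is in $G(U)$ and the other in $F(U)$; (r8) $\#[\exists xT(x)]\in G(U)$ iff $\#T(\mathbf n)\in G(U)$ for some numeral $\mathbf n$, and $\in F(U)$ iff $\#T(\mathbf n)\in F(U)$ for every numeral $\mathbf n$; (r9) $\#[\forall xT(x)]\in G(U)$ iff $\#T(\mathbf n)\in G(U)$ for every numeral $\mathbf n$, and $\in F(U)$ iff $\#T(\mathbf n)\in F(U)$ for some numeral $\mathbf n$. A set $U\subseteq D$ is consistent if there is no sentence $A$ of $\mathcal L$ with both $\#A\in U$ and $\#[\neg A]\in U$; $\mathcal P$ denotes the family of consistent subsets of $D$, ordered by inclusion. A set $V\in\mathcal P$ is sound if $V\subseteq G(V)$. -}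

module Defs where

open import Level using (Level; 0ℓ; _⊔_) renaming (suc to lsuc)
open import Data.Nat using (ℕ)
open import Data.Bool using (Bool; true; false)
open import Data.Product using (Σ; _×_; _,_)
open import Data.Sum using (_⊎_)
open import Data.Empty using (⊥)
open import Relation.Nullary using (¬_)
open import Relation.Unary using (Pred; _⊆_; _⊂_; _≐_)
open import Relation.Binary.PropositionalEquality using (_≡_)
open import Relation.Binary.Structures using (IsStrictTotalOrder)
open import Induction.WellFounded using (WellFounded)
open import Function.Definitions using (Injective)
open import Axiom.ExcludedMiddle using (ExcludedMiddle) public

-- A mathematically agreeable language L, represented by what the
-- construction of G and F uses: its (countable) set of sentences and the
-- full classical interpretation assigning each sentence exactly one of
-- the values true / false.
record MALanguage : Set₁ where
  field
    SentenceL : Set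
    value     : SentenceL → Bool

module _ (L : MALanguage) where
  open MALanguage L

  data Sentence : Set where
    base : SentenceL → Sentence
    T    : ℕ → Sentence
    ∀T   : Sentence
    ∃T   : Sentence
    ¬ₛ   : Sentence → Sentence
    _∨ₛ_ : Sentence → Sentence → Sentence
    _∧ₛ_ : Sentence → Sentence → Sentence
    _⇒ₛ_ : Sentence → Sentence → Sentence
    _⇔ₛ_ : Sentence → Sentence → Sentence

  record GödelNumbering : Set where
    field
      #_    : Sentence → ℕ
      #-inj : Injective _≡_ _≡_ #_

module _ {L : MALanguage} (g : GödelNumbering L) where
  open MALanguage L
  open GödelNumbering g

  D : Pred ℕ 0ℓ
  D k = Σ (Sentence L) λ A → # A ≡ k

  W : Pred ℕ 0ℓ
  W k = Σ SentenceL λ a → (# base a ≡ k) × (value a ≡ true)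

  -- Rules (r1)-(r9), by recursion on sentences: Gₛ U A means #A ∈ G(U),
  -- Fₛ U A means #A ∈ F(U).
  GT FT : Pred ℕ 0ℓ → ℕ → Set
  GT U n = Σ (Sentence L) λ A → (# A ≡ n) × U (# A)
  FT U n = Σ (Sentence L) λ A → (# A ≡ n) × U (# (¬ₛ A))

  Gₛ Fₛ : Pred ℕ 0ℓ → Sentence L → Set
  Gₛ U (base a)  = value a ≡ true
  Gₛ U (T n)     = GT U n
  Gₛ U ∀T        = (n : ℕ) → GT U n
  Gₛ U ∃T        = Σ ℕ λ n → GT U n
  Gₛ U (¬ₛ A)    = Fₛ U A
  Gₛ U (A ∨ₛ B)  = Gₛ U A ⊎ Gₛ U B
  Gₛ U (A ∧ₛ B)  = Gₛ U A × Gₛ U B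
  Gₛ U (A ⇒ₛ B)  = Fₛ U A ⊎ Gₛ U B
  Gₛ U (A ⇔ₛ B)  = (Gₛ U A × Gₛ U B) ⊎ (Fₛ U A × Fₛ U B)
  Fₛ U (base a)  = value a ≡ false
  Fₛ U (T n)     = FT U n
  Fₛ U ∀T        = Σ ℕ λ n → FT U n
  Fₛ U ∃T        = (n : ℕ) → FT U n
  Fₛ U (¬ₛ A)    = Gₛ U A
  Fₛ U (A ∨ₛ B)  = Fₛ U A × Fₛ U B
  Fₛ U (A ∧ₛ B)  = Fₛ U A ⊎ Fₛ U B
  Fₛ U (A ⇒ₛ B)  = Gₛ U A × Fₛ U B
  Fₛ U (A ⇔ₛ B)  = (Gₛ U A × Fₛ U B) ⊎ (Fₛ U A × Gₛ U B)

  G F : Pred ℕ 0ℓ → Pred ℕ 0ℓ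
  G U k = Σ (Sentence L) λ A → (# A ≡ k) × Gₛ U A
  F U k = Σ (Sentence L) λ A → (# A ≡ k) × Fₛ U A

  Consistent : Pred ℕ 0ℓ → Set
  Consistent U = (A : Sentence L) → U (# A) → U (# (¬ₛ A)) → ⊥

  InP : Pred ℕ 0ℓ → Set
  InP U = (U ⊆ D) × Consistent U

  Sound : Pred ℕ 0ℓ → Set
  Sound V = InP V × (V ⊆ G V)

  IsLeastConsistentFixedPoint : Pred ℕ 0ℓ → Set₁
  IsLeastConsistentFixedPoint U =
    InP U × (U ≐ G U) × ((U′ : Pred ℕ 0ℓ) → InP U′ → U′ ≐ G U′ → U ⊆ U′)

-- Ordinals, represented as well-orders (well-founded strict total orders).
record Ordinal (ℓ : Level) : Set (lsuc ℓ) where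
  field
    Carrier : Set ℓ
    _<_     : Carrier → Carrier → Set ℓ
    isSTO   : IsStrictTotalOrder _≡_ _<_
    wf      : WellFounded _<_

  IsZero : Carrier → Set ℓ
  IsZero z = (x : Carrier) → ¬ (x < z)

  IsLast : Carrier → Set ℓ
  IsLast t = (x : Carrier) → ¬ (t < x)

module _ {L : MALanguage} (g : GödelNumbering L) where

  record CSequence (ℓ : Level) (V : Pred ℕ 0ℓ) : Set (lsuc ℓ) where
    field
      α       : Ordinal ℓ
    open Ordinal α
    field
      U       : Carrier → Pred ℕ 0ℓ
      inP     : (λ′ : Carrier) → InP g (U λ′)
      strict  : {μ ν : Carrier} → μ < ν → U μ ⊂ U ν
      atZero  : (z : Carrier) → IsZero z → U z ≐ V
      later   : (μ : Carrier) → ¬ IsZero μ →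
                U μ ≐ (λ k → Σ Carrier λ λ′ → (λ′ < μ) × G g (U λ′) k)

  -- S′ is an initial segment of S (so S contains S′ in the union).
  record InitialSegment {ℓ ℓ′ : Level} {V : Pred ℕ 0ℓ}
                        (S′ : CSequence ℓ′ V) (S : CSequence ℓ V) : Set (ℓ ⊔ ℓ′) where
    private
      module A′ = Ordinal (CSequence.α S′)
      module A  = Ordinal (CSequence.α S)
    field
      f        : A′.Carrier → A.Carrier
      mono     : {x y : A′.Carrier} → x A′.< y → f x A.< f y
      downward : (x : A′.Carrier) (y : A.Carrier) → y A.< f x →
                 Σ A′.Carrier λ x′ → f x′ ≡ y
      agree    : (x : A′.Carrier) → CSequence.U S′ x ≐ CSequence.U S (f x)

-- G is monotone, maps consistent sets to consistent sets, and on consistent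
-- sets it is finitary: the only infinitary clauses, for ∀xT(x) and ∃xT(x),
-- can never fire "for every numeral", since a consistent set cannot contain
-- both ⌜∀xT(x)⌝ and ⌜¬∀xT(x)⌝.  So from a sound V the iterates Gⁿ(V) increase
-- and their union G^ω(V) is a consistent fixed point lying below every fixed
-- point containing V.  Condition (C) leaves no freedom: by well-founded
-- induction every term of a (C)-sequence is some Gⁿ(V) or G^ω(V), strictly
-- increasing along the sequence.  Hence every (C)-sequence is an initial
-- segment of the one indexed by the stages reached before the iteration
-- stabilises, and its last term is the least consistent fixed point.
module Submission where

open import Defs
open import Level using (0ℓ; _⊔_; Lift; lift; lower) renaming (suc to lsuc)
open import Data.Nat using (ℕ; zero; suc; _≤_; _<_; _≤′_; z≤n; s≤s; ≤′-refl; ≤′-step)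
  renaming (_⊔_ to _⊔ℕ_)
open import Data.Nat.Properties
  using (≤⇒≤′; m≤m⊔n; m≤n⊔m; <-trans; <-irrefl; <-cmp; ≤-refl; ≤-trans; <⇒≤)
  using (m<1+n⇒m<n∨m≡n)
open import Data.Nat.Induction using (<-rec; <-wellFounded)
open import Data.Product using (Σ; _×_; _,_; proj₁; proj₂; map₂)
open import Data.Sum using (inj₁; inj₂)
open import Data.Unit using (⊤; tt)
open import Data.Empty using (⊥; ⊥-elim; ⊥-elim-irr)
open import Relation.Nullary using (¬_; yes; no)
open import Relation.Nullary.Decidable using (map′)
open import Relation.Unary using (Pred; _⊆_; _≐_)
open import Relation.Unary.Properties using (≐-sym; ≐-trans)
open import Relation.Binary.Definitions using (Trichotomous; tri<; tri≈; tri>)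
open import Relation.Binary.Structures using (IsStrictTotalOrder)
open import Relation.Binary.Structures.Biased using (isStrictTotalOrderᶜ)
open import Relation.Binary.PropositionalEquality using (_≡_; refl; sym; trans; isEquivalence)
open import Induction.WellFounded using (WellFounded; Acc; acc)
import Induction.WellFounded as WF
import Relation.Binary.Construct.On as On

em-lower : ∀ {a b} → ExcludedMiddle (a ⊔ b) → ExcludedMiddle a
em-lower {b = b} em = map′ lower lift (em {Lift b _})

least-witness : ExcludedMiddle 0ℓ → {P : ℕ → Set} → ∀ {n} → P n →
                Σ ℕ λ m → P m × (∀ {k} → k < m → ¬ P k)
least-witness em {P} {n} = <-rec (λ n → P n → Least) search n
  where
    Least : Set
    Least = Σ ℕ λ m → P m × (∀ {k} → k < m → ¬ P k)
    search : ∀ n → (∀ {k} → k < n → P k → Least) → P n → Least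
    search n below pn with em {Σ ℕ λ k → k < n × P k}
    ... | yes (k , k<n , pk) = below k<n pk
    ... | no none = n , pn , λ k<n pk → none (_ , k<n , pk)

eventually-× : {P Q : ℕ → Set} →
               (∀ {m n} → m ≤ n → P m → P n) → (∀ {m n} → m ≤ n → Q m → Q n) →
               Σ ℕ P → Σ ℕ Q → Σ ℕ λ n → P n × Q n
eventually-× P-up Q-up (m , p) (n , q) = m ⊔ℕ n , P-up (m≤m⊔n m n) p , Q-up (m≤n⊔m m n) q

module Operator {L : MALanguage} (g : GödelNumbering L) where
  open GödelNumbering g

  module _ {U U′ : Pred ℕ 0ℓ} (U⊆U′ : U ⊆ U′) where
    GT-mono : ∀ {n} → GT g U n → GT g U′ n
    GT-mono (A , e , u) = A , e , U⊆U′ u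

    FT-mono : ∀ {n} → FT g U n → FT g U′ n
    FT-mono (A , e , u) = A , e , U⊆U′ u

    Gₛ-mono : ∀ A → Gₛ g U A → Gₛ g U′ A
    Fₛ-mono : ∀ A → Fₛ g U A → Fₛ g U′ A
    Gₛ-mono (base a) p = p
    Gₛ-mono (T n) p = GT-mono p
    Gₛ-mono ∀T p = λ n → GT-mono (p n)
    Gₛ-mono ∃T (n , p) = n , GT-mono p
    Gₛ-mono (¬ₛ A) p = Fₛ-mono A p
    Gₛ-mono (A ∨ₛ B) (inj₁ p) = inj₁ (Gₛ-mono A p)
    Gₛ-mono (A ∨ₛ B) (inj₂ q) = inj₂ (Gₛ-mono B q)
    Gₛ-mono (A ∧ₛ B) (p , q) = Gₛ-mono A p , Gₛ-mono B q
    Gₛ-mono (A ⇒ₛ B) (inj₁ p) = inj₁ (Fₛ-mono A p)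
    Gₛ-mono (A ⇒ₛ B) (inj₂ q) = inj₂ (Gₛ-mono B q)
    Gₛ-mono (A ⇔ₛ B) (inj₁ (p , q)) = inj₁ (Gₛ-mono A p , Gₛ-mono B q)
    Gₛ-mono (A ⇔ₛ B) (inj₂ (p , q)) = inj₂ (Fₛ-mono A p , Fₛ-mono B q)
    Fₛ-mono (base a) p = p
    Fₛ-mono (T n) p = FT-mono p
    Fₛ-mono ∀T (n , p) = n , FT-mono p
    Fₛ-mono ∃T p = λ n → FT-mono (p n)
    Fₛ-mono (¬ₛ A) p = Gₛ-mono A p
    Fₛ-mono (A ∨ₛ B) (p , q) = Fₛ-mono A p , Fₛ-mono B q
    Fₛ-mono (A ∧ₛ B) (inj₁ p) = inj₁ (Fₛ-mono A p)
    Fₛ-mono (A ∧ₛ B) (inj₂ q) = inj₂ (Fₛ-mono B q)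
    Fₛ-mono (A ⇒ₛ B) (p , q) = Gₛ-mono A p , Fₛ-mono B q
    Fₛ-mono (A ⇔ₛ B) (inj₁ (p , q)) = inj₁ (Gₛ-mono A p , Fₛ-mono B q)
    Fₛ-mono (A ⇔ₛ B) (inj₂ (p , q)) = inj₂ (Fₛ-mono A p , Gₛ-mono B q)

    G-mono : G g U ⊆ G g U′
    G-mono (A , e , p) = A , e , Gₛ-mono A p

  G-cong : ∀ {U U′} → U ≐ U′ → G g U ≐ G g U′
  G-cong (U⊆U′ , U′⊆U) = G-mono U⊆U′ , G-mono U′⊆U

  module _ {U : Pred ℕ 0ℓ} (consistent : Consistent g U) where
    GT-FT-disjoint : ∀ {n} → GT g U n → FT g U n → ⊥
    GT-FT-disjoint (A , e , u) (B , e′ , v) with #-inj (trans e (sym e′))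
    ... | refl = consistent A u v

    Gₛ-Fₛ-disjoint : ∀ A → Gₛ g U A → Fₛ g U A → ⊥
    Gₛ-Fₛ-disjoint (base a) p q with trans (sym p) q
    ... | ()
    Gₛ-Fₛ-disjoint (T n) p q = GT-FT-disjoint p q
    Gₛ-Fₛ-disjoint ∀T p (n , q) = GT-FT-disjoint (p n) q
    Gₛ-Fₛ-disjoint ∃T (n , p) q = GT-FT-disjoint p (q n)
    Gₛ-Fₛ-disjoint (¬ₛ A) p q = Gₛ-Fₛ-disjoint A q p
    Gₛ-Fₛ-disjoint (A ∨ₛ B) (inj₁ p) (q , _) = Gₛ-Fₛ-disjoint A p q
    Gₛ-Fₛ-disjoint (A ∨ₛ B) (inj₂ p) (_ , q) = Gₛ-Fₛ-disjoint B p q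
    Gₛ-Fₛ-disjoint (A ∧ₛ B) (p , _) (inj₁ q) = Gₛ-Fₛ-disjoint A p q
    Gₛ-Fₛ-disjoint (A ∧ₛ B) (_ , p) (inj₂ q) = Gₛ-Fₛ-disjoint B p q
    Gₛ-Fₛ-disjoint (A ⇒ₛ B) (inj₁ q) (p , _) = Gₛ-Fₛ-disjoint A p q
    Gₛ-Fₛ-disjoint (A ⇒ₛ B) (inj₂ p) (_ , q) = Gₛ-Fₛ-disjoint B p q
    Gₛ-Fₛ-disjoint (A ⇔ₛ B) (inj₁ (_ , p)) (inj₁ (_ , q)) = Gₛ-Fₛ-disjoint B p q
    Gₛ-Fₛ-disjoint (A ⇔ₛ B) (inj₁ (p , _)) (inj₂ (q , _)) = Gₛ-Fₛ-disjoint A p q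
    Gₛ-Fₛ-disjoint (A ⇔ₛ B) (inj₂ (q , _)) (inj₁ (p , _)) = Gₛ-Fₛ-disjoint A p q
    Gₛ-Fₛ-disjoint (A ⇔ₛ B) (inj₂ (_ , q)) (inj₂ (_ , p)) = Gₛ-Fₛ-disjoint B p q

    G-consistent : Consistent g (G g U)
    G-consistent A (A₁ , e₁ , p) (A₂ , e₂ , q) with #-inj e₁ | #-inj e₂
    ... | refl | refl = Gₛ-Fₛ-disjoint A p q

    ¬-all-GT : ¬ (∀ n → GT g U n)
    ¬-all-GT all with all (# ∀T) | all (# (¬ₛ ∀T))
    ... | A , e , u | B , e′ , v with #-inj e | #-inj e′
    ... | refl | refl = consistent ∀T u v

    ¬-all-FT : ¬ (∀ n → FT g U n)
    ¬-all-FT all with all (# ∀T) | all (# (¬ₛ ∀T))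
    ... | A , e , u | B , e′ , v with #-inj e | #-inj e′
    ... | refl | refl = consistent (¬ₛ ∀T) u v

  G⊆D : ∀ {U} → G g U ⊆ D g
  G⊆D (A , e , _) = A , e

  G-InP : ∀ {U} → Consistent g U → InP g (G g U)
  G-InP consistent = G⊆D , G-consistent consistent

  W⊆G : ∀ {U} → W g ⊆ G g U
  W⊆G (a , e , true-a) = base a , e , true-a

  W-sound : ∀ {V} → V ⊆ W g → Sound g V
  W-sound {V} V⊆W = ((λ v → G⊆D (V⊆G v)) , consistent) , V⊆G
    where
      V⊆G : V ⊆ G g V
      V⊆G v = W⊆G (V⊆W v)

      consistent : Consistent g V
      consistent A u v with V⊆W v
      ... | b , e , _ with #-inj e
      ... | ()

data ℕ∞ : Set where
  fin : ℕ → ℕ∞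
  ω   : ℕ∞

-- Valued in Set₁ so that it can serve directly as the order of an Ordinal (lsuc 0ℓ).
data _<∞_ : ℕ∞ → ℕ∞ → Set₁ where
  f<f : ∀ {m n} → m < n → fin m <∞ fin n
  f<ω : ∀ {m} → fin m <∞ ω

<∞-trans : ∀ {a b c} → a <∞ b → b <∞ c → a <∞ c
<∞-trans (f<f p) (f<f q) = f<f (<-trans p q)
<∞-trans (f<f p) f<ω = f<ω
<∞-trans f<ω ()

<∞-cmp : Trichotomous _≡_ _<∞_
<∞-cmp (fin m) (fin n) with <-cmp m n
... | tri< m<n _ _ =
  tri< (f<f m<n) (λ { refl → <-irrefl refl m<n }) (λ { (f<f n<m) → <-irrefl refl (<-trans m<n n<m) })
... | tri≈ _ refl _ =
  tri≈ (λ { (f<f m<m) → <-irrefl refl m<m }) refl (λ { (f<f m<m) → <-irrefl refl m<m })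
... | tri> _ _ n<m =
  tri> (λ { (f<f m<n) → <-irrefl refl (<-trans m<n n<m) }) (λ { refl → <-irrefl refl n<m }) (f<f n<m)
<∞-cmp (fin m) ω = tri< f<ω (λ ()) (λ ())
<∞-cmp ω (fin n) = tri> (λ ()) (λ ()) f<ω
<∞-cmp ω ω = tri≈ (λ ()) refl (λ ())

fin-acc : ∀ {n} → Acc _<_ n → Acc _<∞_ (fin n)
fin-acc (acc rs) = acc λ { (f<f p) → fin-acc (rs p) }

<∞-wellFounded : WellFounded _<∞_
<∞-wellFounded (fin n) = fin-acc (<-wellFounded n)
<∞-wellFounded ω = acc λ { (f<ω {m}) → fin-acc (<-wellFounded m) }

_≼_ : ℕ → ℕ∞ → Set
n ≼ fin m = n ≤ m
n ≼ ω = ⊤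

z≼ : ∀ r → 0 ≼ r
z≼ (fin m) = z≤n
z≼ ω = tt

≼-<∞ : ∀ {n a b} → n ≼ a → a <∞ b → suc n ≼ b
≼-<∞ n≤m (f<f m<k) = ≤-trans (s≤s n≤m) m<k
≼-<∞ _ f<ω = tt

suc-≼⇒<∞ : ∀ {n r} → suc n ≼ r → fin n <∞ r
suc-≼⇒<∞ {r = fin m} n<m = f<f n<m
suc-≼⇒<∞ {r = ω} _ = f<ω

<∞⇒suc-≼ : ∀ {n r} → fin n <∞ r → suc n ≼ r
<∞⇒suc-≼ (f<f n<m) = n<m
<∞⇒suc-≼ f<ω = tt

module Iteration {L : MALanguage} (g : GödelNumbering L) {V : Pred ℕ 0ℓ} (V-sound : Sound g V) where
  open Operator g

  infix 10 G^_
  G^_ : ℕ → Pred ℕ 0ℓ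
  G^ zero = V
  G^ suc n = G g (G^ n)

  G^ω : Pred ℕ 0ℓ
  G^ω k = Σ ℕ λ n → (G^ n) k

  G^-step : ∀ n → G^ n ⊆ G^ suc n
  G^-step zero = proj₂ V-sound
  G^-step (suc n) = G-mono (G^-step n)

  G^-mono : ∀ {m n} → m ≤ n → G^ m ⊆ G^ n
  G^-mono m≤n = mono′ (≤⇒≤′ m≤n)
    where
      mono′ : ∀ {m n} → m ≤′ n → G^ m ⊆ G^ n
      mono′ ≤′-refl p = p
      mono′ {n = suc n} (≤′-step m≤′n) p = G^-step n (mono′ m≤′n p)

  G^-InP : ∀ n → InP g (G^ n)
  G^-InP zero = proj₁ V-sound
  G^-InP (suc n) = G-InP (proj₂ (G^-InP n))

  G^ω-consistent : Consistent g G^ω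
  G^ω-consistent A (m , p) (n , q) =
    proj₂ (G^-InP (m ⊔ℕ n)) A (G^-mono (m≤m⊔n m n) p) (G^-mono (m≤n⊔m m n) q)

  G^ω-InP : InP g G^ω
  G^ω-InP = (λ { (n , p) → proj₁ (G^-InP n) p }) , G^ω-consistent

  Gₛ-G^-mono : ∀ A {m n} → m ≤ n → Gₛ g (G^ m) A → Gₛ g (G^ n) A
  Gₛ-G^-mono A m≤n = Gₛ-mono (G^-mono m≤n) A

  Fₛ-G^-mono : ∀ A {m n} → m ≤ n → Fₛ g (G^ m) A → Fₛ g (G^ n) A
  Fₛ-G^-mono A m≤n = Fₛ-mono (G^-mono m≤n) A

  Gₛ-continuous : ∀ A → Gₛ g G^ω A → Σ ℕ λ n → Gₛ g (G^ n) A
  Fₛ-continuous : ∀ A → Fₛ g G^ω A → Σ ℕ λ n → Fₛ g (G^ n) A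
  Gₛ-continuous (base a) p = 0 , p
  Gₛ-continuous (T k) (A , e , n , p) = n , A , e , p
  Gₛ-continuous ∀T p = ⊥-elim (¬-all-GT {G^ω} G^ω-consistent p)
  Gₛ-continuous ∃T (k , A , e , n , p) = n , k , A , e , p
  Gₛ-continuous (¬ₛ A) p = Fₛ-continuous A p
  Gₛ-continuous (A ∨ₛ B) (inj₁ p) = map₂ inj₁ (Gₛ-continuous A p)
  Gₛ-continuous (A ∨ₛ B) (inj₂ q) = map₂ inj₂ (Gₛ-continuous B q)
  Gₛ-continuous (A ∧ₛ B) (p , q) =
    eventually-× (Gₛ-G^-mono A) (Gₛ-G^-mono B) (Gₛ-continuous A p) (Gₛ-continuous B q)
  Gₛ-continuous (A ⇒ₛ B) (inj₁ p) = map₂ inj₁ (Fₛ-continuous A p)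
  Gₛ-continuous (A ⇒ₛ B) (inj₂ q) = map₂ inj₂ (Gₛ-continuous B q)
  Gₛ-continuous (A ⇔ₛ B) (inj₁ (p , q)) =
    map₂ inj₁ (eventually-× (Gₛ-G^-mono A) (Gₛ-G^-mono B) (Gₛ-continuous A p) (Gₛ-continuous B q))
  Gₛ-continuous (A ⇔ₛ B) (inj₂ (p , q)) =
    map₂ inj₂ (eventually-× (Fₛ-G^-mono A) (Fₛ-G^-mono B) (Fₛ-continuous A p) (Fₛ-continuous B q))
  Fₛ-continuous (base a) p = 0 , p
  Fₛ-continuous (T k) (A , e , n , p) = n , A , e , p
  Fₛ-continuous ∀T (k , A , e , n , p) = n , k , A , e , p
  Fₛ-continuous ∃T p = ⊥-elim (¬-all-FT {G^ω} G^ω-consistent p)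
  Fₛ-continuous (¬ₛ A) p = Gₛ-continuous A p
  Fₛ-continuous (A ∨ₛ B) (p , q) =
    eventually-× (Fₛ-G^-mono A) (Fₛ-G^-mono B) (Fₛ-continuous A p) (Fₛ-continuous B q)
  Fₛ-continuous (A ∧ₛ B) (inj₁ p) = map₂ inj₁ (Fₛ-continuous A p)
  Fₛ-continuous (A ∧ₛ B) (inj₂ q) = map₂ inj₂ (Fₛ-continuous B q)
  Fₛ-continuous (A ⇒ₛ B) (p , q) =
    eventually-× (Gₛ-G^-mono A) (Fₛ-G^-mono B) (Gₛ-continuous A p) (Fₛ-continuous B q)
  Fₛ-continuous (A ⇔ₛ B) (inj₁ (p , q)) =
    map₂ inj₁ (eventually-× (Gₛ-G^-mono A) (Fₛ-G^-mono B) (Gₛ-continuous A p) (Fₛ-continuous B q))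
  Fₛ-continuous (A ⇔ₛ B) (inj₂ (p , q)) =
    map₂ inj₂ (eventually-× (Fₛ-G^-mono A) (Gₛ-G^-mono B) (Fₛ-continuous A p) (Gₛ-continuous B q))

  G^ω-fixed : G^ω ≐ G g G^ω
  G^ω-fixed = (λ { (n , p) → G-mono (λ q → n , q) (G^-step n p) })
            , (λ { (A , e , p) → let (n , q) = Gₛ-continuous A p in suc n , A , e , q })

  G^-least : ∀ {U} → V ⊆ U → G g U ⊆ U → ∀ n → G^ n ⊆ U
  G^-least V⊆U closed zero = V⊆U
  G^-least V⊆U closed (suc n) p = closed (G-mono (G^-least V⊆U closed n) p)

  stage : ℕ∞ → Pred ℕ 0ℓ
  stage (fin n) = G^ n
  stage ω = G^ω

  stage-InP : ∀ r → InP g (stage r)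
  stage-InP (fin n) = G^-InP n
  stage-InP ω = G^ω-InP

  stage⊆G^ω : ∀ r → stage r ⊆ G^ω
  stage⊆G^ω (fin n) p = n , p
  stage⊆G^ω ω p = p

  stage-least : ∀ {U} → V ⊆ U → G g U ⊆ U → ∀ r → stage r ⊆ U
  stage-least V⊆U closed (fin n) = G^-least V⊆U closed n
  stage-least V⊆U closed ω (n , p) = G^-least V⊆U closed n p

  stage-leastFixedPoint : (∀ {U} → V ⊆ G g U) → ∀ r → stage r ≐ G g (stage r) →
                          IsLeastConsistentFixedPoint g (stage r)
  stage-leastFixedPoint V⊆G r fixed =
    stage-InP r , fixed , λ U _ (_ , closed) → stage-least (λ v → closed (V⊆G v)) closed r

  stage-≼ : ∀ {n r} → n ≼ r → G^ n ⊆ stage r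
  stage-≼ {r = fin m} n≤m = G^-mono n≤m
  stage-≼ {n} {ω} _ p = n , p

  stage-mono : ∀ {s t} → s <∞ t → stage s ⊆ stage t
  stage-mono (f<f m<n) = G^-mono (<⇒≤ m<n)
  stage-mono (f<ω {m}) p = m , p

  stage-mono-≮ : ∀ {s t} → ¬ (t <∞ s) → stage s ⊆ stage t
  stage-mono-≮ {s} {t} t≮s with <∞-cmp s t
  ... | tri< s<t _ _ = stage-mono s<t
  ... | tri≈ _ refl _ = λ p → p
  ... | tri> _ _ t<s = ⊥-elim (t≮s t<s)

  Unstabilised : ℕ∞ → Set₁
  Unstabilised r = ∀ s → fin s <∞ r → ¬ (G^ suc s ⊆ G^ s)

  Unstabilised-down : ∀ {q r} → Unstabilised r → q <∞ r → Unstabilised q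
  Unstabilised-down unstable q<r s s<q = unstable s (<∞-trans s<q q<r)

  stage-strict : ∀ {s t} → Unstabilised t → s <∞ t → ¬ (stage t ⊆ stage s)
  stage-strict {fin m} unstable m<t t⊆m =
    unstable m m<t (λ p → t⊆m (stage-≼ (<∞⇒suc-≼ m<t) p))

  stage-injective : ∀ {s t} → .(Unstabilised s) → .(Unstabilised t) →
                    stage s ⊆ stage t → stage t ⊆ stage s → s ≡ t
  stage-injective {s} {t} unstable-s unstable-t s⊆t t⊆s with <∞-cmp s t
  ... | tri< s<t _ _ = ⊥-elim-irr (stage-strict unstable-t s<t t⊆s)
  ... | tri≈ _ s≡t _ = s≡t
  ... | tri> _ _ t<s = ⊥-elim-irr (stage-strict unstable-s t<s s⊆t)

  -- The canonical (C)-sequence runs through the stages reached before the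
  -- iteration stabilises; the proof is irrelevant so that equal ranks give
  -- equal indices.
  record Index : Set₁ where
    constructor index
    field
      rank          : ℕ∞
      .unstabilised : Unstabilised rank
  open Index public using (rank)

  index-≡ : ∀ {s t} .{u : Unstabilised s} .{v : Unstabilised t} →
            s ≡ t → index s u ≡ index t v
  index-≡ refl = refl

  _<ᵢ_ : Index → Index → Set₁
  i <ᵢ j = rank i <∞ rank j

  <ᵢ-cmp : Trichotomous _≡_ _<ᵢ_
  <ᵢ-cmp (index s _) (index t _) with <∞-cmp s t
  ... | tri< s<t s≢t t≮s = tri< s<t (λ { refl → s≢t refl }) t≮s
  ... | tri≈ s≮t refl t≮s = tri≈ s≮t refl t≮s
  ... | tri> s≮t s≢t t<s = tri> s≮t (λ { refl → s≢t refl }) t<s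

  indices : Ordinal (lsuc 0ℓ)
  indices = record
    { Carrier = Index
    ; _<_ = _<ᵢ_
    ; isSTO = isStrictTotalOrderᶜ record
        { isEquivalence = isEquivalence ; trans = <∞-trans ; compare = <ᵢ-cmp }
    ; wf = On.wellFounded rank <∞-wellFounded
    }

  index₀ : Index
  index₀ = index (fin 0) λ { _ (f<f ()) }

  canonical-atZero : (z : Index) → Ordinal.IsZero indices z → stage (rank z) ≐ V
  canonical-atZero (index (fin zero) _) _ = (λ p → p) , (λ p → p)
  canonical-atZero (index (fin (suc n)) _) is-zero = ⊥-elim (is-zero index₀ (f<f (s≤s z≤n)))
  canonical-atZero (index ω _) is-zero = ⊥-elim (is-zero index₀ f<ω)

  canonical-later : (μ : Index) → ¬ Ordinal.IsZero indices μ →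
                    stage (rank μ) ≐ (λ k → Σ Index λ λ′ → (λ′ <ᵢ μ) × G g (stage (rank λ′)) k)
  canonical-later (index (fin zero) _) nonzero =
    ⊥-elim (nonzero λ { (index (fin _) _) (f<f ()) ; (index ω _) () })
  canonical-later (index (fin (suc n)) unstable) _ =
    (λ p → index (fin n) (Unstabilised-down unstable (f<f ≤-refl)) , f<f ≤-refl , p) ,
    (λ { (index (fin m) _ , f<f (s≤s m≤n) , p) → G-mono (G^-mono m≤n) p })
  canonical-later (index ω unstable) _ =
    (λ { (n , p) → index (fin n) (Unstabilised-down unstable f<ω) , f<ω , G^-step n p }) ,
    (λ { (index (fin m) _ , f<ω , p) → suc m , p })

  canonical : CSequence g (lsuc 0ℓ) V
  canonical = record
    { α = indices
    ; U = λ i → stage (rank i)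
    ; inP = λ i → stage-InP (rank i)
    ; strict = λ { {ν = index _ unstable} μ<ν →
                   stage-mono μ<ν , λ ν⊆μ → ⊥-elim-irr (stage-strict unstable μ<ν ν⊆μ) }
    ; atZero = canonical-atZero
    ; later = canonical-later
    }

  -- The last index is the first s with Gˢ⁺¹(V) ⊆ Gˢ(V), or ω if there is none.
  last-fixed-index : ExcludedMiddle 0ℓ →
                     Σ Index λ t → Ordinal.IsLast indices t × stage (rank t) ≐ G g (stage (rank t))
  last-fixed-index em with em {Σ ℕ λ s → G^ suc s ⊆ G^ s}
  ... | no never = index ω (λ s _ stable → never (s , stable)) , (λ _ ()) , G^ω-fixed
  ... | yes (s , stable) with least-witness em {P = λ s → G^ suc s ⊆ G^ s} {s} stable
  ...   | m , stable-m , unstable-below =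
    index (fin m) (λ { s (f<f s<m) → unstable-below s<m }) ,
    (λ { (index _ unstable) m<r → ⊥-elim-irr (unstable m m<r stable-m) }) ,
    G^-step m , stable-m

  module Embedding (em : ExcludedMiddle (lsuc 0ℓ)) (S′ : CSequence g (lsuc 0ℓ) V) where
    open CSequence S′ using ()
      renaming (α to α′; U to U′; strict to strict′; atZero to atZero′; later to later′)
    open Ordinal α′ using ()
      renaming (Carrier to C′; _<_ to _<′_; isSTO to isSTO′; wf to wf′; IsZero to IsZero′)
    open IsStrictTotalOrder isSTO′ using () renaming (compare to compare′)

    U′-strict : ∀ {x y} → x <′ y → ¬ (U′ y ⊆ U′ x)
    U′-strict x<y = proj₂ (strict′ x<y)

    U′-mono-≮ : ∀ {x y} → ¬ (y <′ x) → U′ x ⊆ U′ y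
    U′-mono-≮ {x} {y} y≮x with compare′ x y
    ... | tri< x<y _ _ = proj₁ (strict′ x<y)
    ... | tri≈ _ refl _ = λ u → u
    ... | tri> _ _ y<x = ⊥-elim (y≮x y<x)

    record Matched (x : C′) : Set₁ where
      constructor matched
      field
        height       : ℕ∞
        unstabilised : Unstabilised height
        agrees       : U′ x ≐ stage height
        below        : ∀ {r} → r <∞ height → Σ C′ λ x′ → U′ x′ ≐ stage r

      image : Index
      image = index height unstabilised
    open Matched

    module _ {x y} (mx : Matched x) (my : Matched y) (x<y : x <′ y) where
      matched-¬¬mono : ¬ ¬ (height mx <∞ height my)
      matched-¬¬mono hx≮hy =
        U′-strict x<y λ u → proj₂ (agrees mx) (stage-mono-≮ hx≮hy (proj₁ (agrees my) u))

      matched-mono : height mx <∞ height my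
      matched-mono with <∞-cmp (height mx) (height my)
      ... | tri< hx<hy _ _ = hx<hy
      ... | tri≈ hx≮hy _ _ = ⊥-elim (matched-¬¬mono hx≮hy)
      ... | tri> hx≮hy _ _ = ⊥-elim (matched-¬¬mono hx≮hy)

    matched-zero : ∀ {x} → IsZero′ x → Matched x
    matched-zero is-zero = matched (fin 0) (λ { _ (f<f ()) }) (atZero′ _ is-zero) (λ { (f<f ()) })

    HasLastPredecessor : C′ → Set₁
    HasLastPredecessor x =
      Σ C′ λ y → (y <′ x) × (∀ {y′} → y′ <′ x → ¬ (y <′ y′))

    module _ {x : C′} (nonzero : ¬ IsZero′ x) (ih : ∀ {y} → y <′ x → Matched y) where
      matched-successor : HasLastPredecessor x → Matched x
      matched-successor (y , y<x , last) = from (ih y<x)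
        where
          successor : U′ x ≐ G g (U′ y)
          successor =
            (λ u → let (y′ , y′<x , p) = proj₁ (later′ x nonzero) u
                   in G-mono (U′-mono-≮ (last y′<x)) p) ,
            (λ p → proj₂ (later′ x nonzero) (y , y<x , p))

          grows : ∀ {P} → U′ y ≐ P → U′ x ≐ G g P
          grows U′y≐P = ≐-trans successor (G-cong U′y≐P)

          from : Matched y → Matched x
          -- G^ω is already a fixed point, so nothing lies strictly above it.
          from (matched ω _ agrees-y _) =
            ⊥-elim (U′-strict y<x λ u →
                      proj₂ agrees-y (proj₂ G^ω-fixed (proj₁ (grows agrees-y) u)))
          from (matched (fin n) unstable agrees-y below-y) =
            matched (fin (suc n)) unstable′ (grows agrees-y) below-x
            where
              unstable′ : Unstabilised (fin (suc n))
              unstable′ s (f<f s<1+n) with m<1+n⇒m<n∨m≡n s<1+n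
              ... | inj₁ s<n = unstable s (f<f s<n)
              ... | inj₂ refl =
                λ stable → U′-strict y<x λ u →
                             proj₂ agrees-y (stable (proj₁ (grows agrees-y) u))

              below-x : ∀ {r} → r <∞ fin (suc n) → Σ C′ λ x′ → U′ x′ ≐ stage r
              below-x (f<f m<1+n) with m<1+n⇒m<n∨m≡n m<1+n
              ... | inj₁ m<n = below-y (f<f m<n)
              ... | inj₂ refl = y , agrees-y

      matched-limit : ¬ HasLastPredecessor x → Matched x
      matched-limit no-last = matched ω unstable agrees-x below-x
        where
          some-predecessor : Σ C′ λ y → y <′ x
          some-predecessor with em {Σ C′ λ y → y <′ x}
          ... | yes p = p
          ... | no none = ⊥-elim (nonzero λ y y<x → none (y , y<x))

          later-predecessor : ∀ {y} → y <′ x → Σ C′ λ y′ → (y′ <′ x) × (y <′ y′)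
          later-predecessor {y} y<x with em {Σ C′ λ y′ → (y′ <′ x) × (y <′ y′)}
          ... | yes p = p
          ... | no none = ⊥-elim (no-last (y , y<x , λ y′<x y<y′ → none (_ , y′<x , y<y′)))

          cofinal : ∀ n → Σ C′ λ y → Σ (y <′ x) λ y<x → n ≼ height (ih y<x)
          cofinal zero = let (y , y<x) = some-predecessor in y , y<x , z≼ _
          cofinal (suc n) =
            let (y , y<x , n≼) = cofinal n
                (y′ , y′<x , y<y′) = later-predecessor y<x
            in y′ , y′<x , ≼-<∞ n≼ (matched-mono (ih y<x) (ih y′<x) y<y′)

          U′x⊆G^ω : U′ x ⊆ G^ω
          U′x⊆G^ω u =
            let (y , y<x , p) = proj₁ (later′ x nonzero) u
                my = ih y<x
            in proj₂ G^ω-fixed (G-mono (λ q → stage⊆G^ω (height my) (proj₁ (agrees my) q)) p)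

          G^ω⊆U′x : G^ω ⊆ U′ x
          G^ω⊆U′x (n , p) =
            let (y , y<x , n≼) = cofinal n
            in proj₂ (later′ x nonzero)
                 (y , y<x , G-mono (λ q → proj₂ (agrees (ih y<x)) (stage-≼ n≼ q)) (G^-step n p))

          agrees-x : U′ x ≐ G^ω
          agrees-x = U′x⊆G^ω , G^ω⊆U′x

          unstable : Unstabilised ω
          unstable s _ =
            let (y , y<x , s+1≼) = cofinal (suc s) in unstabilised (ih y<x) s (suc-≼⇒<∞ s+1≼)

          below-x : ∀ {r} → r <∞ ω → Σ C′ λ x′ → U′ x′ ≐ stage r
          below-x (f<ω {m}) =
            let (y , y<x , m+1≼) = cofinal (suc m) in below (ih y<x) (suc-≼⇒<∞ m+1≼)

    matched-all : ∀ x → Matched x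
    matched-all = WF.All.wfRec wf′ (lsuc 0ℓ) Matched step
      where
        step : ∀ x → (∀ {y} → y <′ x → Matched y) → Matched x
        step x ih with em {IsZero′ x} | em {HasLastPredecessor x}
        ... | yes is-zero | _ = matched-zero is-zero
        ... | no nonzero | yes last = matched-successor nonzero ih last
        ... | no nonzero | no no-last = matched-limit nonzero ih no-last

    downward : ∀ x (i : Index) → i <ᵢ image (matched-all x) →
               Σ C′ λ x′ → image (matched-all x′) ≡ i
    downward x (index r unstable) r<hx =
      let (x′ , U′x′≐r) = below (matched-all x) r<hx
          stage≐r = ≐-trans (≐-sym (agrees (matched-all x′))) U′x′≐r
      in x′ , index-≡ (stage-injective (unstabilised (matched-all x′)) unstable
                                       (proj₁ stage≐r) (proj₂ stage≐r))

    embedding : InitialSegment g S′ canonical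
    embedding = record
      { f        = λ x → image (matched-all x)
      ; mono     = matched-mono (matched-all _) (matched-all _)
      ; downward = downward
      ; agree    = λ x → agrees (matched-all x)
      }

corollary3p5 : (L : MALanguage) (g : GödelNumbering L) (V : Pred ℕ 0ℓ) → V ⊆ W g →
    Sound g V
    × (ExcludedMiddle (lsuc (lsuc 0ℓ)) →
       Σ (CSequence g (lsuc 0ℓ) V) λ S →
         ((S′ : CSequence g (lsuc 0ℓ) V) → InitialSegment g S′ S)
         × Σ (Ordinal.Carrier (CSequence.α S)) λ top →
             Ordinal.IsLast (CSequence.α S) top
             × IsLeastConsistentFixedPoint g (CSequence.U S top))
corollary3p5 L g V V⊆W = V-sound , λ em →
  let (top , top-last , top-fixed) = last-fixed-index (em-lower em)
  in canonical , Embedding.embedding (em-lower em) , top , top-last ,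
     stage-leastFixedPoint (λ v → W⊆G (V⊆W v)) (rank top) top-fixed
  where
    open Operator g
    V-sound : Sound g V
    V-sound = W-sound V⊆W
    open Iteration g V-sound
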